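{- Let $G$ be a distance-regular graph with diameter $D$ on $n\ge2$ vertices and let $v\in V(G)$. Then the set $S=\{v\}$ gives a $D$-approximation of the sparsity and a $2D$-approximation of the isoperimetric number, i.e. \[ \sigma_G(\{v\})\le D\,\sigma(G)\qquad\text{and}\qquad \frac{|\partial(\{v\})|}{1}\le 2D\, i(G). \]
   Context: For a graph $G=(V,E)$ on $n$ vertices and $S\subseteq V$, $\partial(S)$ is the set of edges with exactly one endpoint in $S$; $\sigma_G(S)=|\partial(S)|/(|S||V\setminus S|)$; the sparsity is $\sigma(G)=\min\{\sigma_G(S):\emptyset\ne S\ne V\}$; the isoperimetric number is $i(G)=\min\{|\partial(S)|/|S|: 1\le|S|\le n/2\}$. A connected graph of diameter $D$ is distance-regular if for all $i$ and all vertices $u,v$ with $d(u,v)=i$ the numbers of neighbours of $v$ at distance $i-1$, $i$, $i+1$ from $u$ depend only on $i$. -}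

module Defs where

open import Data.Bool using (Bool; true; false; _∧_; _∨_; not; T; T?)
open import Data.Nat as ℕ using (ℕ; zero; suc; _∸_)
open import Data.Integer using (+_)
open import Data.Rational using (ℚ; _/_)
open import Data.Fin using (Fin; _≟_)
open import Data.Fin.Subset using (Subset)
open import Data.Vec using (lookup)
open import Data.List using (List; filter; length; allFin; cartesianProduct)
open import Data.Bool.ListAction using (any)
open import Data.Product using (_×_; _,_; proj₁; proj₂; ∃; ∃-syntax)
open import Relation.Binary.PropositionalEquality using (_≡_)
open import Relation.Nullary.Decidable using (Dec; yes; no; isYes)
open import Relation.Nullary using (¬_)

record Graph (n : ℕ) : Set where
  field
    adj    : Fin n → Fin n → Bool
    sym    : ∀ u v → adj u v ≡ adj v u
    irrefl : ∀ u → adj u u ≡ false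
open Graph public

module _ {n : ℕ} (G : Graph n) where

  -- within k u v = true iff there is a walk of length ≤ k from u to v, i.e. d(u,v) ≤ k.
  within : ℕ → Fin n → Fin n → Bool
  within zero    u v = isYes (u ≟ v)
  within (suc k) u v = within k u v ∨ any (λ w → adj G u w ∧ within k w v) (allFin n)

  distB : Fin n → Fin n → ℕ → Bool
  distB u v zero    = within zero u v
  distB u v (suc i) = within (suc i) u v ∧ not (within i u v)

  nbrsAt : Fin n → Fin n → ℕ → ℕ
  nbrsAt u v j = length (filter (λ w → T? (adj G v w ∧ distB u w j)) (allFin n))

  HasDiameter : ℕ → Set
  HasDiameter D = (∀ u v → T (within D u v)) × (∃[ u ] ∃[ v ] T (distB u v D))

  DistanceRegular : Set
  DistanceRegular =
    ∀ i u v u′ v′ → T (distB u v i) → T (distB u′ v′ i) →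
      (nbrsAt u v (i ∸ 1) ≡ nbrsAt u′ v′ (i ∸ 1)) ×
      (nbrsAt u v i ≡ nbrsAt u′ v′ i) ×
      (nbrsAt u v (suc i) ≡ nbrsAt u′ v′ (suc i))

  -- |∂(S)| : number of edges with exactly one endpoint in S
  -- (counted as ordered pairs (x,y) with x ∈ S, y ∉ S, x ~ y: each such edge once)
  boundary : Subset n → ℕ
  boundary S = length (filter (λ p → T? (lookup S (proj₁ p) ∧ not (lookup S (proj₂ p)) ∧ adj G (proj₁ p) (proj₂ p)))
                              (cartesianProduct (allFin n) (allFin n)))

-- a / b as a rational, with the convention a / 0 = 0 (only used with b ≠ 0)
frac : ℕ → ℕ → ℚ
frac a zero    = + 0 / 1
frac a (suc b) = + a / suc b

ℕ→ℚ : ℕ → ℚ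
ℕ→ℚ a = + a / 1

open import Data.Fin.Subset using (∣_∣)

module _ {n : ℕ} (G : Graph n) where
  -- σ_G(S) = |∂(S)| / (|S| |V \ S|)   (meaningful for ∅ ≠ S ≠ V)
  sparsityOf : Subset n → ℚ
  sparsityOf S = frac (boundary G S) (∣ S ∣ ℕ.* (n ∸ ∣ S ∣))

  -- |∂(S)| / |S|   (meaningful for S ≠ ∅)
  expansionOf : Subset n → ℚ
  expansionOf S = frac (boundary G S) ∣ S ∣

module Submission where

-- For every source u, send `rate` units of flow to each other vertex along the edges that lead one
-- step farther from u, with weight w_j on every edge from distance j to distance j + 1. In a
-- distance-regular graph a vertex at distance j + 1 has c_{j+1} inward and b_{j+1} outward edges,
-- so the flow is conserved once c_{j+1} w_j = rate + b_{j+1} w_{j+1}; these equations are solved in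
-- ℕ by building the weights from the far end. Counting with the intersection numbers, k times the
-- total flow on any edge xy is at most Σ_{j<D} rate · |{u : d(x,u) > j}| ≤ D · rate · (n − 1).
-- A set S is crossed by at least rate · |S| · |V ∖ S| units from the sources in S, hence
-- k |S| |V ∖ S| ≤ D (n − 1) |∂S|. As |∂{v}| = k and σ({v}) = k / (n − 1), this is the
-- D-approximation of σ(G), and |V ∖ S| ≥ n / 2 turns it into the 2D-approximation of i(G).

open import Defs
open import Data.Nat using (ℕ; _≤_; _<_)
open import Data.Rational using (ℚ) renaming (_≤_ to _≤ℚ_; _*_ to _*ℚ_)
open import Data.Fin using (Fin)
open import Data.Fin.Subset using (Subset; ⁅_⁆; ∣_∣)
open import Data.Product using (_×_)

open import Data.Nat.Properties
open import Algebra.Properties.Semiring.Sum +-*-semiring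
  using (sum; sum-cong-≗; ∑-distrib-+; ∑-comm; *-distribˡ-sum; *-distribʳ-sum)
open import Algebra.Properties.CommutativeSemigroup *-commutativeSemigroup
  using (x∙yz≈z∙yx; x∙yz≈y∙xz; x∙yz≈y∙zx; xy∙z≈xz∙y)
open import Data.Bool using (Bool; true; false; _∧_; not; T; T?; if_then_else_)
open import Data.Bool.Properties using (T-∨; T-≡)
open import Data.Empty using (⊥-elim)
open import Data.Fin using (zero; suc; toℕ; fromℕ<)
open import Data.Fin.Properties using (any?; toℕ-fromℕ<; toℕ<n)
import Data.Fin.Properties as Finₚ
open import Data.Fin.Subset.Properties using (x∈⁅x⁆; x∈⁅y⁆⇒x≡y; ∣⁅x⁆∣≡1)
import Data.Integer as ℤ
import Data.Integer.Properties as ℤₚ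
open import Data.List using ([]; _∷_; _++_; map; filter; length; tabulate; allFin; cartesianProduct)
open import Data.List.Membership.Propositional using (lose)
open import Data.List.Membership.Propositional.Properties using (∈-allFin)
open import Data.List.Properties using (length-++; filter-++)
open import Data.List.Relation.Unary.Any using (satisfied)
open import Data.List.Relation.Unary.Any.Properties using (any⁺; any⁻)
open import Data.Nat using (zero; suc; _+_; _*_; _∸_; z≤n; s≤s; s≤s⁻¹; _≡ᵇ_; _<ᵇ_; >-nonZero)
open import Data.Nat.Tactic.RingSolver using (solve-∀)
open import Data.Product using (_,_; proj₁; proj₂; ∃-syntax)
open import Data.Rational using (_/_; toℚᵘ)
import Data.Rational.Properties as ℚₚ
open import Data.Rational.Unnormalised using (mkℚᵘ)
import Data.Rational.Unnormalised as ℚᵘ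
import Data.Rational.Unnormalised.Properties as ℚᵘₚ
open import Data.Sum using (_⊎_; inj₁; inj₂)
open import Data.Vec using ([]; _∷_; lookup)
open import Data.Vec.Properties using ([]=⇒lookup; lookup⇒[]=)
open import Function using (id; _∘_; _⇔_; mk⇔; Equivalence)
open import Relation.Binary.PropositionalEquality
  using (_≡_; _≢_; refl; trans; cong; cong₂; subst; subst₂; module ≡-Reasoning)
import Relation.Binary.PropositionalEquality as ≡
open import Relation.Nullary using (¬_)
open import Relation.Nullary.Decidable using (Dec; yes; no; toWitness; fromWitness)

-- Indicators and finite sums

T-∧⁺ : ∀ {a b} → T a → T b → T (a ∧ b)
T-∧⁺ {true} _ tb = tb

T-∧⁻ : ∀ a {b} → T (a ∧ b) → T a × T b
T-∧⁻ true t = _ , t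

T-not⁻ : ∀ {b} → T (not b) → ¬ T b
T-not⁻ {false} _ ()

T-not⁺ : ∀ {b} → ¬ T b → T (not b)
T-not⁺ {false} _  = _
T-not⁺ {true}  ¬b = ¬b _

𝟙 : Bool → ℕ
𝟙 true  = 1
𝟙 false = 0

count : ∀ {n} → (Fin n → Bool) → ℕ
count p = sum (𝟙 ∘ p)

𝟙-cong : ∀ {a b} → (T a → T b) → (T b → T a) → 𝟙 a ≡ 𝟙 b
𝟙-cong {false} {false} _ _ = refl
𝟙-cong {false} {true}  _ g = ⊥-elim (g _)
𝟙-cong {true}  {false} f _ = ⊥-elim (f _)
𝟙-cong {true}  {true}  _ _ = refl

𝟙-∧ : ∀ a b → 𝟙 (a ∧ b) ≡ 𝟙 a * 𝟙 b
𝟙-∧ false b = refl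
𝟙-∧ true  b = ≡.sym (+-identityʳ (𝟙 b))

𝟙≤1 : ∀ b → 𝟙 b ≤ 1
𝟙≤1 false = z≤n
𝟙≤1 true  = ≤-refl

𝟙+𝟙-not : ∀ b → 𝟙 b + 𝟙 (not b) ≡ 1
𝟙+𝟙-not false = refl
𝟙+𝟙-not true  = refl

𝟙*-cong : ∀ b {x y} → (T b → x ≡ y) → 𝟙 b * x ≡ 𝟙 b * y
𝟙*-cong false _  = refl
𝟙*-cong true  eq = cong (_+ 0) (eq _)

𝟙*-mono-≤ : ∀ b {x y} → (T b → x ≤ y) → 𝟙 b * x ≤ 𝟙 b * y
𝟙*-mono-≤ false _  = z≤n
𝟙*-mono-≤ true  le = +-monoˡ-≤ 0 (le _)

𝟙*≤ : ∀ b x → 𝟙 b * x ≤ x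
𝟙*≤ false x = z≤n
𝟙*≤ true  x = ≤-reflexive (+-identityʳ x)

𝟙-true : ∀ {b} → T b → 𝟙 b ≡ 1
𝟙-true {true} _ = refl

𝟙-false : ∀ {b} → ¬ T b → 𝟙 b ≡ 0
𝟙-false {false} _  = refl
𝟙-false {true}  ¬b = ⊥-elim (¬b _)

𝟙*-cong₂ : ∀ {a a′ x x′} → (T a → T a′) → (T a′ → T a) → (T a → x ≡ x′) → 𝟙 a * x ≡ 𝟙 a′ * x′
𝟙*-cong₂ {a} {x′ = x′} to from eq = trans (𝟙*-cong a eq) (cong (_* x′) (𝟙-cong to from))

𝟙*≤-intro : ∀ a {x y} → (T a → x ≤ y) → 𝟙 a * x ≤ y
𝟙*≤-intro false _  = z≤n
𝟙*≤-intro true  le = ≤-trans (≤-reflexive (+-identityʳ _)) (le _)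

𝟙-split : ∀ b x → x ≡ 𝟙 b * x + 𝟙 (not b) * x
𝟙-split b x = begin
  x                           ≡⟨ *-identityˡ x ⟨
  1 * x                       ≡⟨ cong (_* x) (𝟙+𝟙-not b) ⟨
  (𝟙 b + 𝟙 (not b)) * x       ≡⟨ *-distribʳ-+ x (𝟙 b) (𝟙 (not b)) ⟩
  𝟙 b * x + 𝟙 (not b) * x     ∎
  where open ≡-Reasoning

𝟙-<ᵇ-split : ∀ j d → 𝟙 (j <ᵇ d) ≡ 𝟙 (d ≡ᵇ suc j) + 𝟙 (suc j <ᵇ d)
𝟙-<ᵇ-split j       zero          = refl
𝟙-<ᵇ-split zero    (suc zero)    = refl
𝟙-<ᵇ-split zero    (suc (suc d)) = refl
𝟙-<ᵇ-split (suc j) (suc d)       = 𝟙-<ᵇ-split j d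

𝟙-<ᵇ+𝟙-≡ᵇ0≤1 : ∀ j d → 𝟙 (j <ᵇ d) + 𝟙 (d ≡ᵇ 0) ≤ 1
𝟙-<ᵇ+𝟙-≡ᵇ0≤1 j       zero    = ≤-refl
𝟙-<ᵇ+𝟙-≡ᵇ0≤1 zero    (suc d) = ≤-refl
𝟙-<ᵇ+𝟙-≡ᵇ0≤1 (suc j) (suc d) = ≤-trans (≤-reflexive (+-identityʳ _)) (𝟙≤1 (j <ᵇ d))

sum-mono-≤ : ∀ {n} {f g : Fin n → ℕ} → (∀ i → f i ≤ g i) → sum f ≤ sum g
sum-mono-≤ {zero}  _  = z≤n
sum-mono-≤ {suc n} le = +-mono-≤ (le zero) (sum-mono-≤ (le ∘ suc))

term≤sum : ∀ {n} (f : Fin n → ℕ) i → f i ≤ sum f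
term≤sum f zero    = m≤m+n (f zero) _
term≤sum f (suc i) = ≤-trans (term≤sum (f ∘ suc) i) (m≤n+m _ (f zero))

sum-const : ∀ n c → sum {n} (λ _ → c) ≡ n * c
sum-const zero    c = refl
sum-const (suc n) c = cong (c +_) (sum-const n c)

sum-zero : ∀ {n} {f : Fin n → ℕ} → (∀ i → f i ≡ 0) → sum f ≡ 0
sum-zero {n} f≡0 = trans (sum-cong-≗ f≡0) (trans (sum-const n 0) (*-zeroʳ n))

sum-𝟙*-unique : ∀ {n} (p : Fin n → Bool) (f : Fin n → ℕ) {v} → T (p v) → (∀ i → T (p i) → i ≡ v) →
                sum (λ i → 𝟙 (p i) * f i) ≡ f v
sum-𝟙*-unique {suc n} p f {zero} pv uniq = begin
  𝟙 (p zero) * f zero + sum (λ i → 𝟙 (p (suc i)) * f (suc i))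
    ≡⟨ cong₂ _+_ (cong (_* f zero) (𝟙-true pv))
                 (sum-zero (λ i → cong (_* f (suc i))
                                       (𝟙-false (λ pi → Finₚ.0≢1+n (≡.sym (uniq (suc i) pi)))))) ⟩
  1 * f zero + 0
    ≡⟨ trans (+-identityʳ _) (*-identityˡ _) ⟩
  f zero ∎
  where open ≡-Reasoning
sum-𝟙*-unique {suc n} p f {suc v} pv uniq =
  cong₂ _+_ (cong (_* f zero) (𝟙-false (λ p0 → Finₚ.0≢1+n (uniq zero p0))))
            (sum-𝟙*-unique (p ∘ suc) (f ∘ suc) pv (λ i pi → Finₚ.suc-injective (uniq (suc i) pi)))

count-pos : ∀ {n} (p : Fin n → Bool) {i} → T (p i) → 1 ≤ count p
count-pos p {i} t = subst (_≤ count p) (𝟙-true t) (term≤sum (𝟙 ∘ p) i)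

count-unique : ∀ {n} (p : Fin n → Bool) {v} → T (p v) → (∀ i → T (p i) → i ≡ v) → count p ≡ 1
count-unique p pv uniq =
  trans (sum-cong-≗ (λ i → ≡.sym (*-identityʳ (𝟙 (p i))))) (sum-𝟙*-unique p (λ _ → 1) pv uniq)

count-not : ∀ {n} (s : Fin n → Bool) → count (not ∘ s) ≡ n ∸ count s
count-not {n} s = begin
  count (not ∘ s)                          ≡⟨ m+n∸m≡n (count s) (count (not ∘ s)) ⟨
  count s + count (not ∘ s) ∸ count s      ≡⟨ cong (_∸ count s) total ⟩
  n ∸ count s                              ∎
  where
  open ≡-Reasoning
  total : count s + count (not ∘ s) ≡ n
  total = begin
    count s + count (not ∘ s)             ≡⟨ ∑-distrib-+ (𝟙 ∘ s) (𝟙 ∘ not ∘ s) ⟨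
    sum (λ i → 𝟙 (s i) + 𝟙 (not (s i)))   ≡⟨ sum-cong-≗ (λ i → 𝟙+𝟙-not (s i)) ⟩
    sum {n} (λ _ → 1)                     ≡⟨ sum-const n 1 ⟩
    n * 1                                 ≡⟨ *-identityʳ n ⟩
    n                                     ∎

count-∧-dropˡ : ∀ {n} {g p q : Fin n → Bool} → (∀ i → T (g i) → T (q i) → T (p i)) →
                count (λ i → g i ∧ (p i ∧ q i)) ≡ count (λ i → g i ∧ q i)
count-∧-dropˡ {g = g} {p} {q} q⇒p = sum-cong-≗ (λ i → drop (g i) (p i) (q i) (q⇒p i))
  where
  drop : ∀ g p q → (T g → T q → T p) → 𝟙 (g ∧ (p ∧ q)) ≡ 𝟙 (g ∧ q)
  drop false _     _     _   = refl
  drop true  true  _     _   = refl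
  drop true  false false _   = refl
  drop true  false true  q⇒p = ⊥-elim (q⇒p _ _)

count-∧-dropʳ : ∀ {n} {g p q : Fin n → Bool} → (∀ i → T (g i) → T (p i) → T (q i)) →
                count (λ i → g i ∧ (p i ∧ q i)) ≡ count (λ i → g i ∧ p i)
count-∧-dropʳ {g = g} {p} {q} p⇒q = sum-cong-≗ (λ i → drop (g i) (p i) (q i) (p⇒q i))
  where
  drop : ∀ g p q → (T g → T p → T q) → 𝟙 (g ∧ (p ∧ q)) ≡ 𝟙 (g ∧ p)
  drop false _     _     _   = refl
  drop true  false _     _   = refl
  drop true  true  true  _   = refl
  drop true  true  false p⇒q = ⊥-elim (p⇒q _ _)

count*≡sum : ∀ {n} (p : Fin n → Bool) (f : Fin n → ℕ) {β} → (∀ i → T (p i) → f i ≡ β) →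
                count p * β ≡ sum (λ i → 𝟙 (p i) * f i)
count*≡sum p f {β} f≡β = trans (*-distribʳ-sum β (𝟙 ∘ p)) (sum-cong-≗ (λ i → 𝟙*-cong (p i) (≡.sym ∘ f≡β i)))

double-count : ∀ {n m} (r : Fin n → Fin m → Bool) (p : Fin n → Bool) (q : Fin m → Bool) {β γ} →
               (∀ i → T (p i) → count (λ j → r i j ∧ q j) ≡ β) →
               (∀ j → T (q j) → count (λ i → r i j ∧ p i) ≡ γ) →
               count p * β ≡ count q * γ
double-count r p q {β} {γ} p-regular q-regular = begin
  count p * β
    ≡⟨ count*≡sum p _ p-regular ⟩
  sum (λ i → 𝟙 (p i) * count (λ j → r i j ∧ q j))
    ≡⟨ sum-cong-≗ (λ i → *-distribˡ-sum (𝟙 (p i)) (λ j → 𝟙 (r i j ∧ q j))) ⟩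
  sum (λ i → sum (λ j → 𝟙 (p i) * 𝟙 (r i j ∧ q j)))
    ≡⟨ sum-cong-≗ (λ i → sum-cong-≗ (λ j → 𝟙-swap (p i) (r i j) (q j))) ⟩
  sum (λ i → sum (λ j → 𝟙 (q j) * 𝟙 (r i j ∧ p i)))
    ≡⟨ ∑-comm (λ i j → 𝟙 (q j) * 𝟙 (r i j ∧ p i)) ⟩
  sum (λ j → sum (λ i → 𝟙 (q j) * 𝟙 (r i j ∧ p i)))
    ≡⟨ sum-cong-≗ (λ j → *-distribˡ-sum (𝟙 (q j)) (λ i → 𝟙 (r i j ∧ p i))) ⟨
  sum (λ j → 𝟙 (q j) * count (λ i → r i j ∧ p i))
    ≡⟨ count*≡sum q _ q-regular ⟨
  count q * γ ∎
  where
  open ≡-Reasoning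
  𝟙-swap : ∀ a r b → 𝟙 a * 𝟙 (r ∧ b) ≡ 𝟙 b * 𝟙 (r ∧ a)
  𝟙-swap a r b = begin
    𝟙 a * 𝟙 (r ∧ b)       ≡⟨ cong (𝟙 a *_) (𝟙-∧ r b) ⟩
    𝟙 a * (𝟙 r * 𝟙 b)     ≡⟨ x∙yz≈z∙yx (𝟙 a) (𝟙 r) (𝟙 b) ⟩
    𝟙 b * (𝟙 r * 𝟙 a)     ≡⟨ cong (𝟙 b *_) (𝟙-∧ r a) ⟨
    𝟙 b * 𝟙 (r ∧ a)       ∎

-- Flows across a cut

crossing : ∀ {n} → (Fin n → Fin n → ℕ) → (Fin n → Bool) → (Fin n → Bool) → ℕ
crossing f p q = sum (λ x → sum (λ y → 𝟙 (p x) * (𝟙 (q y) * f x y)))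

module _ {n : ℕ} where

  ∑∑-distrib-+ : ∀ (f g : Fin n → Fin n → ℕ) →
                 sum (λ x → sum (λ y → f x y + g x y)) ≡ sum (λ x → sum (f x)) + sum (λ x → sum (g x))
  ∑∑-distrib-+ f g =
    trans (sum-cong-≗ (λ x → ∑-distrib-+ (f x) (g x))) (∑-distrib-+ (λ x → sum (f x)) (λ x → sum (g x)))

  crossing-mono-≤ : ∀ {f g : Fin n → Fin n → ℕ} p q → (∀ x y → f x y ≤ g x y) →
                    crossing f p q ≤ crossing g p q
  crossing-mono-≤ p q f≤g =
    sum-mono-≤ (λ x → sum-mono-≤ (λ y → *-monoʳ-≤ (𝟙 (p x)) (*-monoʳ-≤ (𝟙 (q y)) (f≤g x y))))

  *-crossing : ∀ m (f : Fin n → Fin n → ℕ) p q → m * crossing f p q ≡ crossing (λ x y → m * f x y) p q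
  *-crossing m f p q = begin
    m * crossing f p q
      ≡⟨ *-distribˡ-sum m (λ x → sum (λ y → 𝟙 (p x) * (𝟙 (q y) * f x y))) ⟩
    sum (λ x → m * sum (λ y → 𝟙 (p x) * (𝟙 (q y) * f x y)))
      ≡⟨ sum-cong-≗ (λ x → *-distribˡ-sum m (λ y → 𝟙 (p x) * (𝟙 (q y) * f x y))) ⟩
    sum (λ x → sum (λ y → m * (𝟙 (p x) * (𝟙 (q y) * f x y))))
      ≡⟨ sum-cong-≗ (λ x → sum-cong-≗ (λ y → inwards (𝟙 (p x)) (𝟙 (q y)) (f x y))) ⟩
    crossing (λ x y → m * f x y) p q ∎
    where
    open ≡-Reasoning
    inwards : ∀ a b z → m * (a * (b * z)) ≡ a * (b * (m * z))
    inwards a b z = trans (x∙yz≈y∙xz m a (b * z)) (cong (a *_) (x∙yz≈y∙xz m b z))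

  sum-crossing : ∀ {m} (f : Fin m → Fin n → Fin n → ℕ) p q →
                 sum (λ u → crossing (f u) p q) ≡ crossing (λ x y → sum (λ u → f u x y)) p q
  sum-crossing f p q = begin
    sum (λ u → sum (λ x → sum (λ y → 𝟙 (p x) * (𝟙 (q y) * f u x y))))
      ≡⟨ ∑-comm (λ u x → sum (λ y → 𝟙 (p x) * (𝟙 (q y) * f u x y))) ⟩
    sum (λ x → sum (λ u → sum (λ y → 𝟙 (p x) * (𝟙 (q y) * f u x y))))
      ≡⟨ sum-cong-≗ (λ x → ∑-comm (λ u y → 𝟙 (p x) * (𝟙 (q y) * f u x y))) ⟩
    sum (λ x → sum (λ y → sum (λ u → 𝟙 (p x) * (𝟙 (q y) * f u x y))))
      ≡⟨ sum-cong-≗ (λ x → sum-cong-≗ (λ y → pull-out x y)) ⟨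
    crossing (λ x y → sum (λ u → f u x y)) p q ∎
    where
    open ≡-Reasoning
    pull-out : ∀ x y → 𝟙 (p x) * (𝟙 (q y) * sum (λ u → f u x y)) ≡ sum (λ u → 𝟙 (p x) * (𝟙 (q y) * f u x y))
    pull-out x y = trans (cong (𝟙 (p x) *_) (*-distribˡ-sum (𝟙 (q y)) (λ u → f u x y)))
                         (*-distribˡ-sum (𝟙 (p x)) (λ u → 𝟙 (q y) * f u x y))

  inflow-split : ∀ (f : Fin n → Fin n → ℕ) p q →
                 sum (λ y → 𝟙 (q y) * sum (λ x → f x y)) ≡ crossing f p q + crossing f (not ∘ p) q
  inflow-split f p q = begin
    sum (λ y → 𝟙 (q y) * sum (λ x → f x y))
      ≡⟨ sum-cong-≗ (λ y → *-distribˡ-sum (𝟙 (q y)) (λ x → f x y)) ⟩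
    sum (λ y → sum (λ x → 𝟙 (q y) * f x y))
      ≡⟨ ∑-comm (λ y x → 𝟙 (q y) * f x y) ⟩
    sum (λ x → sum (λ y → 𝟙 (q y) * f x y))
      ≡⟨ sum-cong-≗ (λ x → sum-cong-≗ (λ y → 𝟙-split (p x) (𝟙 (q y) * f x y))) ⟩
    sum (λ x → sum (λ y → 𝟙 (p x) * (𝟙 (q y) * f x y) + 𝟙 (not (p x)) * (𝟙 (q y) * f x y)))
      ≡⟨ ∑∑-distrib-+ (λ x y → 𝟙 (p x) * (𝟙 (q y) * f x y)) (λ x y → 𝟙 (not (p x)) * (𝟙 (q y) * f x y)) ⟩
    crossing f p q + crossing f (not ∘ p) q ∎
    where open ≡-Reasoning

  outflow-split : ∀ (f : Fin n → Fin n → ℕ) p q →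
                  sum (λ x → 𝟙 (p x) * sum (λ y → f x y)) ≡ crossing f p q + crossing f p (not ∘ q)
  outflow-split f p q = begin
    sum (λ x → 𝟙 (p x) * sum (λ y → f x y))
      ≡⟨ sum-cong-≗ (λ x → *-distribˡ-sum (𝟙 (p x)) (λ y → f x y)) ⟩
    sum (λ x → sum (λ y → 𝟙 (p x) * f x y))
      ≡⟨ sum-cong-≗ (λ x → sum-cong-≗ (λ y → split (p x) (q y) (f x y))) ⟩
    sum (λ x → sum (λ y → 𝟙 (p x) * (𝟙 (q y) * f x y) + 𝟙 (p x) * (𝟙 (not (q y)) * f x y)))
      ≡⟨ ∑∑-distrib-+ (λ x y → 𝟙 (p x) * (𝟙 (q y) * f x y)) (λ x y → 𝟙 (p x) * (𝟙 (not (q y)) * f x y)) ⟩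
    crossing f p q + crossing f p (not ∘ q) ∎
    where
    open ≡-Reasoning
    split : ∀ a b z → 𝟙 a * z ≡ 𝟙 a * (𝟙 b * z) + 𝟙 a * (𝟙 (not b) * z)
    split a b z = trans (cong (𝟙 a *_) (𝟙-split b z)) (*-distribˡ-+ (𝟙 a) (𝟙 b * z) (𝟙 (not b) * z))

  -- Summing the conservation law over the complement of s, the flow inside the complement cancels.
  demand≤crossing : ∀ (f : Fin n → Fin n → ℕ) (s : Fin n → Bool) {P} →
                   (∀ y → T (not (s y)) → sum (λ x → f x y) ≡ P + sum (λ z → f y z)) →
                   P * count (not ∘ s) ≤ crossing f s (not ∘ s)
  demand≤crossing f s {P} conserved = begin
    P * count (not ∘ s)
      ≤⟨ m≤m+n (P * count (not ∘ s)) (crossing f (not ∘ s) s) ⟩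
    P * count (not ∘ s) + crossing f (not ∘ s) s
      ≡⟨ +-cancelʳ-≡ (crossing f (not ∘ s) (not ∘ s)) _ _ balance ⟨
    crossing f s (not ∘ s) ∎
    where
    open ≤-Reasoning
    balance : crossing f s (not ∘ s) + crossing f (not ∘ s) (not ∘ s) ≡
              (P * count (not ∘ s) + crossing f (not ∘ s) s) + crossing f (not ∘ s) (not ∘ s)
    balance = begin-equality
      crossing f s (not ∘ s) + crossing f (not ∘ s) (not ∘ s)
        ≡⟨ inflow-split f s (not ∘ s) ⟨
      sum (λ y → 𝟙 (not (s y)) * sum (λ x → f x y))
        ≡⟨ sum-cong-≗ (λ y → 𝟙*-cong (not (s y)) (conserved y)) ⟩
      sum (λ y → 𝟙 (not (s y)) * (P + sum (λ z → f y z)))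
        ≡⟨ sum-cong-≗ (λ y → *-distribˡ-+ (𝟙 (not (s y))) P (sum (λ z → f y z))) ⟩
      sum (λ y → 𝟙 (not (s y)) * P + 𝟙 (not (s y)) * sum (λ z → f y z))
        ≡⟨ ∑-distrib-+ (λ y → 𝟙 (not (s y)) * P) (λ y → 𝟙 (not (s y)) * sum (λ z → f y z)) ⟩
      sum (λ y → 𝟙 (not (s y)) * P) + sum (λ y → 𝟙 (not (s y)) * sum (λ z → f y z))
        ≡⟨ cong₂ _+_ (trans (≡.sym (*-distribʳ-sum P (𝟙 ∘ not ∘ s))) (*-comm (count (not ∘ s)) P))
                     (outflow-split f (not ∘ s) s) ⟩
      P * count (not ∘ s) + (crossing f (not ∘ s) s + crossing f (not ∘ s) (not ∘ s))
        ≡⟨ +-assoc (P * count (not ∘ s)) _ _ ⟨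
      (P * count (not ∘ s) + crossing f (not ∘ s) s) + crossing f (not ∘ s) (not ∘ s) ∎

length-filter-map : ∀ {A B : Set} (p : B → Bool) (h : A → B) xs →
                    length (filter (T? ∘ p) (map h xs)) ≡ length (filter (T? ∘ p ∘ h) xs)
length-filter-map p h []       = refl
length-filter-map p h (x ∷ xs) with p (h x)
... | true  = cong suc (length-filter-map p h xs)
... | false = length-filter-map p h xs

length-filter-tabulate : ∀ {A : Set} {n} (p : A → Bool) (f : Fin n → A) →
                         length (filter (T? ∘ p) (tabulate f)) ≡ count (p ∘ f)
length-filter-tabulate {n = zero}  p f = refl
length-filter-tabulate {n = suc n} p f with p (f zero)
... | true  = cong suc (length-filter-tabulate p (f ∘ suc))
... | false = length-filter-tabulate p (f ∘ suc)

length-filter-cartesianProduct : ∀ {A B : Set} {n m} (p : A × B → Bool) (f : Fin n → A) (g : Fin m → B) →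
                                 length (filter (T? ∘ p) (cartesianProduct (tabulate f) (tabulate g))) ≡
                                 sum (λ i → count (λ j → p (f i , g j)))
length-filter-cartesianProduct {n = zero}  p f g = refl
length-filter-cartesianProduct {n = suc n} p f g = begin
  length (filter (T? ∘ p) (map (f zero ,_) (tabulate g) ++ rest))
    ≡⟨ cong length (filter-++ (T? ∘ p) (map (f zero ,_) (tabulate g)) rest) ⟩
  length (filter (T? ∘ p) (map (f zero ,_) (tabulate g)) ++ filter (T? ∘ p) rest)
    ≡⟨ length-++ (filter (T? ∘ p) (map (f zero ,_) (tabulate g))) ⟩
  length (filter (T? ∘ p) (map (f zero ,_) (tabulate g))) + length (filter (T? ∘ p) rest)
    ≡⟨ cong₂ _+_ (trans (length-filter-map p (f zero ,_) (tabulate g)) (length-filter-tabulate _ g))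
                 (length-filter-cartesianProduct p (f ∘ suc) g) ⟩
  sum (λ i → count (λ j → p (f i , g j))) ∎
  where
  open ≡-Reasoning
  rest = cartesianProduct (tabulate (f ∘ suc)) (tabulate g)

-- Layered flows

downward-induction : ∀ {ℓ} (P : ℕ → Set ℓ) N → (∀ j → N ≤ j → P j) → (∀ j → j < N → P (suc j) → P j) →
                     ∀ j → P j
downward-induction P N beyond step j = go N j (m≤m+n N j)
  where
  go : ∀ t j → N ≤ t + j → P j
  go zero    j N≤j = beyond j N≤j
  go (suc t) j N≤t+j with N ≤? j
  ... | yes N≤j = beyond j N≤j
  ... | no  N≰j = step j (≰⇒> N≰j) (go t (suc j) (subst (N ≤_) (≡.sym (+-suc t j)) N≤t+j))

2*m≤n⇒m≤n∸m : ∀ {m n} → 2 * m ≤ n → m ≤ n ∸ m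
2*m≤n⇒m≤n∸m {m} {n} 2m≤n = m+n≤o⇒m≤o∸n m (subst (_≤ n) (cong (m +_) (+-identityʳ m)) 2m≤n)

2*m≤n⇒n≤2*[n∸m] : ∀ {m n} → 2 * m ≤ n → n ≤ 2 * (n ∸ m)
2*m≤n⇒n≤2*[n∸m] {m} {n} 2m≤n = begin
  n                     ≡⟨ m+[n∸m]≡n (≤-trans (m≤m+n m (m + 0)) 2m≤n) ⟨
  m + (n ∸ m)           ≤⟨ +-monoˡ-≤ (n ∸ m) (2*m≤n⇒m≤n∸m 2m≤n) ⟩
  (n ∸ m) + (n ∸ m)     ≡⟨ cong ((n ∸ m) +_) (+-identityʳ (n ∸ m)) ⟨
  2 * (n ∸ m)           ∎
  where open ≤-Reasoning

module _ (p : ℕ → Bool) where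

  least : ℕ → ℕ
  least zero    = zero
  least (suc N) = if p N then least N else suc N

  least≤ : ∀ N → least N ≤ N
  least≤ zero = z≤n
  least≤ (suc N) with p N
  ... | true  = m≤n⇒m≤1+n (least≤ N)
  ... | false = ≤-refl

  module _ (p-suc : ∀ i → T (p i) → T (p (suc i))) where

    upward-closed : ∀ {i j} → i ≤ j → T (p i) → T (p j)
    upward-closed {i} i≤j pi with m≤n⇒∃[o]m+o≡n i≤j
    ... | o , refl = go o
      where
      go : ∀ o → T (p (i + o))
      go zero    = subst (T ∘ p) (≡.sym (+-identityʳ i)) pi
      go (suc o) = subst (T ∘ p) (≡.sym (+-suc i o)) (p-suc (i + o) (go o))

    least-spec : ∀ {N} → T (p N) → ∀ i → T (p i) ⇔ least N ≤ i
    least-spec {zero}  p0 i = mk⇔ (λ _ → z≤n) (λ _ → upward-closed z≤n p0)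
    least-spec {suc N} pN i with p N in eq
    ... | true  = least-spec (subst T (≡.sym eq) _) i
    ... | false = mk⇔ (λ pi → ≰⇒> (λ i≤N → subst T eq (upward-closed i≤N pi)))
                      (λ N<i → upward-closed N<i pN)

record LayerFlow (b c : ℕ → ℕ) (N : ℕ) : Set where
  field
    rate     : ℕ
    rate-pos : 1 ≤ rate
    weight   : ℕ → ℕ
    balance  : ∀ i → i < N → c i * weight i ≡ rate + b i * weight (suc i)

-- Prepending a layer multiplies the old rate and weights by c 0, which keeps them integral.
layerFlow : ∀ (b c : ℕ → ℕ) N → (∀ i → i < N → 1 ≤ c i) → LayerFlow b c N
layerFlow b c zero    _     = record { rate = 1 ; rate-pos = ≤-refl ; weight = λ _ → 0 ; balance = λ _ () }
layerFlow b c (suc N) c-pos = record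
  { rate     = c 0 * rate
  ; rate-pos = *-mono-≤ (c-pos 0 (s≤s z≤n)) rate-pos
  ; weight   = weight′
  ; balance  = balance′
  }
  where
  open LayerFlow (layerFlow (b ∘ suc) (c ∘ suc) N (λ i i<N → c-pos (suc i) (s≤s i<N)))
  weight′ : ℕ → ℕ
  weight′ zero    = rate + b 0 * weight 0
  weight′ (suc i) = c 0 * weight i
  scale : ∀ a r β w → a * (r + β * w) ≡ a * r + β * (a * w)
  scale = solve-∀
  balance′ : ∀ i → i < suc N → c i * weight′ i ≡ c 0 * rate + b i * weight′ (suc i)
  balance′ zero    _         = scale (c 0) rate (b 0) (weight 0)
  balance′ (suc i) (s≤s i<N) = begin
    c (suc i) * (c 0 * weight i)                    ≡⟨ x∙yz≈y∙xz (c (suc i)) (c 0) (weight i) ⟩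
    c 0 * (c (suc i) * weight i)                    ≡⟨ cong (c 0 *_) (balance i i<N) ⟩
    c 0 * (rate + b (suc i) * weight (suc i))       ≡⟨ scale (c 0) rate (b (suc i)) (weight (suc i)) ⟩
    c 0 * rate + b (suc i) * (c 0 * weight (suc i)) ∎
    where open ≡-Reasoning

-- Graph distance

module _ {n : ℕ} (G : Graph n) where

  adj-sym : ∀ {x y} → T (adj G x y) → T (adj G y x)
  adj-sym {x} {y} = subst T (Graph.sym G x y)

  adj-irrefl : ∀ {x} → ¬ T (adj G x x)
  adj-irrefl {x} = subst T (Graph.irrefl G x)

  within-suc : ∀ k {u v} → T (within G k u v) → T (within G (suc k) u v)
  within-suc k t = Equivalence.from T-∨ (inj₁ t)

  within-cons : ∀ k {u w v} → T (adj G u w) → T (within G k w v) → T (within G (suc k) u v)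
  within-cons k {w = w} a t = Equivalence.from T-∨ (inj₂ (any⁺ _ (lose (∈-allFin w) (T-∧⁺ a t))))

  within-uncons : ∀ k {u v} → T (within G (suc k) u v) →
                  T (within G k u v) ⊎ ∃[ w ] T (adj G u w) × T (within G k w v)
  within-uncons k {u} t with Equivalence.to T-∨ t
  ... | inj₁ t′ = inj₁ t′
  ... | inj₂ t′ with satisfied (any⁻ _ (allFin n) t′)
  ...   | w , t″ = inj₂ (w , T-∧⁻ (adj G u w) t″)

  within-snoc : ∀ k {u w v} → T (within G k u w) → T (adj G w v) → T (within G (suc k) u v)
  within-snoc zero t a with toWitness t
  ... | refl = within-cons zero a (fromWitness refl)
  within-snoc (suc k) t a with within-uncons k t
  ... | inj₁ t′             = within-suc (suc k) (within-snoc k t′ a)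
  ... | inj₂ (w , a′ , t′) = within-cons (suc k) a′ (within-snoc k t′ a)

  within-sym : ∀ k {u v} → T (within G k u v) → T (within G k v u)
  within-sym zero t with toWitness t
  ... | refl = t
  within-sym (suc k) {u} t with within-uncons k t
  ... | inj₁ t′            = within-suc k (within-sym k t′)
  ... | inj₂ (w , a , t′) = within-snoc k (within-sym k t′) (adj-sym a)

module Metric {n : ℕ} (G : Graph n) (D : ℕ) (diameter : HasDiameter G D) where

  dist : Fin n → Fin n → ℕ
  dist u v = least (λ i → within G i u v) D

  within⇔dist≤ : ∀ {u v} i → T (within G i u v) ⇔ dist u v ≤ i
  within⇔dist≤ {u} {v} = least-spec _ (λ i → within-suc G i) {D} (proj₁ diameter u v)

  within⇒dist≤ : ∀ {u v i} → T (within G i u v) → dist u v ≤ i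
  within⇒dist≤ {i = i} = Equivalence.to (within⇔dist≤ i)

  dist≤⇒within : ∀ {u v i} → dist u v ≤ i → T (within G i u v)
  dist≤⇒within {i = i} = Equivalence.from (within⇔dist≤ i)

  dist≤D : ∀ u v → dist u v ≤ D
  dist≤D u v = least≤ _ D

  distB⇒dist≡ : ∀ {u v} i → T (distB G u v i) → dist u v ≡ i
  distB⇒dist≡ zero    t = n≤0⇒n≡0 (within⇒dist≤ t)
  distB⇒dist≡ {u} {v} (suc i) t with T-∧⁻ (within G (suc i) u v) t
  ... | w , ¬w = ≤-antisym (within⇒dist≤ w) (≰⇒> (T-not⁻ ¬w ∘ dist≤⇒within))

  dist≡⇒distB : ∀ {u v} i → dist u v ≡ i → T (distB G u v i)
  dist≡⇒distB zero    e = dist≤⇒within (≤-reflexive e)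
  dist≡⇒distB (suc i) e =
    T-∧⁺ (dist≤⇒within (≤-reflexive e)) (T-not⁺ (λ w → 1+n≰n (subst (_≤ i) e (within⇒dist≤ w))))

  𝟙-distB : ∀ u v i → 𝟙 (distB G u v i) ≡ 𝟙 (dist u v ≡ᵇ i)
  𝟙-distB u v i = 𝟙-cong (≡⇒≡ᵇ (dist u v) i ∘ distB⇒dist≡ i) (dist≡⇒distB i ∘ ≡ᵇ⇒≡ (dist u v) i)

  dist-refl : ∀ u → dist u u ≡ 0
  dist-refl u = n≤0⇒n≡0 (within⇒dist≤ (fromWitness refl))

  dist≡0⇒≡ : ∀ {u v} → dist u v ≡ 0 → u ≡ v
  dist≡0⇒≡ e = toWitness (dist≤⇒within (≤-reflexive e))

  dist-sym : ∀ u v → dist u v ≡ dist v u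
  dist-sym u v = ≤-antisym (within⇒dist≤ (within-sym G (dist v u) (dist≤⇒within {v} {u} ≤-refl)))
                           (within⇒dist≤ (within-sym G (dist u v) (dist≤⇒within {u} {v} ≤-refl)))

  dist-adjʳ : ∀ {a b} z → T (adj G a b) → dist z b ≤ suc (dist z a)
  dist-adjʳ {a} z a~b = within⇒dist≤ (within-snoc G (dist z a) (dist≤⇒within {z} {a} ≤-refl) a~b)

  adj⇒dist≡1 : ∀ {a b} → T (adj G a b) → dist a b ≡ 1
  adj⇒dist≡1 {a} {b} t = ≤-antisym (subst (λ d → dist a b ≤ suc d) (dist-refl a) (dist-adjʳ a t))
                                   (n≢0⇒n>0 (λ e → adj-irrefl G (subst (T ∘ adj G a) (≡.sym (dist≡0⇒≡ e)) t)))

  geodesic-step : ∀ {u v j} → dist u v ≡ suc j → ∃[ w ] T (adj G v w) × dist u w ≡ j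
  geodesic-step {u} {v} {j} e
    with within-uncons G j (within-sym G (suc j) (dist≤⇒within {u} {v} (≤-reflexive e)))
  ... | inj₁ t = ⊥-elim (1+n≰n (subst (_≤ j) (trans (dist-sym v u) e) (within⇒dist≤ t)))
  ... | inj₂ (w , a , t) = w , a , ≤-antisym (subst (_≤ j) (dist-sym w u) (within⇒dist≤ t))
                                             (s≤s⁻¹ (subst (_≤ suc (dist u w)) e (dist-adjʳ u (adj-sym G a))))

  dist-adjˡ : ∀ {a b} z → T (adj G a b) → dist b z ≤ suc (dist a z)
  dist-adjˡ {a} {b} z t = subst₂ (λ d d′ → d ≤ suc d′) (dist-sym z b) (dist-sym z a) (dist-adjʳ z t)

  dist-intermediate : ∀ k {u v m} → dist u v ≡ m + k → ∃[ w ] dist u w ≡ m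
  dist-intermediate zero    {v = v} {m} e = v , trans e (+-identityʳ m)
  dist-intermediate (suc k) {m = m}     e with geodesic-step (trans e (+-suc m k))
  ... | w , _ , e′ = dist-intermediate k e′

  distance-realised : ∀ {m} → m ≤ D → ∃[ u ] ∃[ v ] dist u v ≡ m
  distance-realised {m} m≤D with proj₂ diameter
  ... | u , v , t = u , dist-intermediate (D ∸ m) (trans (distB⇒dist≡ D t) (≡.sym (m+[n∸m]≡n m≤D)))

-- Intersection numbers

module IntersectionNumbers {n : ℕ} (G : Graph n) (D : ℕ) (diameter : HasDiameter G D)
                           (regular : DistanceRegular G) where

  open Metric G D diameter public

  nbrsAt≡count : ∀ u v j → nbrsAt G u v j ≡ count (λ w → adj G v w ∧ distB G u w j)
  nbrsAt≡count u v j = length-filter-tabulate (λ w → adj G v w ∧ distB G u w j) id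

  pair-at? : ∀ i → Dec (∃[ u ] ∃[ v ] T (distB G u v i))
  pair-at? i = any? (λ u → any? (λ v → T? (distB G u v i)))

  -- Read off an arbitrary pair at distance i (junk value 0 if there is none);
  -- DistanceRegular makes the choice irrelevant.
  b c : ℕ → ℕ
  b i with pair-at? i
  ... | yes (u , v , _) = nbrsAt G u v (suc i)
  ... | no _            = 0
  c i with pair-at? i
  ... | yes (u , v , _) = nbrsAt G u v (i ∸ 1)
  ... | no _            = 0

  k : ℕ
  k = b 0

  count-outward : ∀ {u v i} → dist u v ≡ i → count (λ w → adj G v w ∧ distB G u w (suc i)) ≡ b i
  count-outward {u} {v} {i} e with pair-at? i
  ... | yes (u′ , v′ , t′) = trans (≡.sym (nbrsAt≡count u v (suc i)))
                                   (proj₂ (proj₂ (regular i u v u′ v′ (dist≡⇒distB i e) t′)))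
  ... | no ∄             = ⊥-elim (∄ (u , v , dist≡⇒distB i e))

  count-inward : ∀ {u v j} → dist u v ≡ suc j → count (λ w → adj G v w ∧ distB G u w j) ≡ c (suc j)
  count-inward {u} {v} {j} e with pair-at? (suc j)
  ... | yes (u′ , v′ , t′) = trans (≡.sym (nbrsAt≡count u v j))
                                   (proj₁ (regular (suc j) u v u′ v′ (dist≡⇒distB (suc j) e) t′))
  ... | no ∄             = ⊥-elim (∄ (u , v , dist≡⇒distB (suc j) e))

  c-pos : ∀ {j} → suc j ≤ D → 1 ≤ c (suc j)
  c-pos {j} sj≤D with distance-realised sj≤D
  ... | u , v , e with geodesic-step e
  ...   | w , a , e′ = subst (1 ≤_) (count-inward e)
                                (count-pos (λ x → adj G v x ∧ distB G u x j) (T-∧⁺ a (dist≡⇒distB j e′)))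

  count-adj-sym : ∀ (p : Fin n → Bool) w → count (λ u → adj G u w ∧ p u) ≡ count (λ u → adj G w u ∧ p u)
  count-adj-sym p w = sum-cong-≗ (λ u → cong (λ a → 𝟙 (a ∧ p u)) (Graph.sym G u w))

  sphere : ℕ → Fin n → ℕ
  sphere j x = count (λ u → distB G x u j)

  sphere-zero : ∀ x → sphere 0 x ≡ 1
  sphere-zero x = count-unique _ (dist≡⇒distB 0 (dist-refl x)) (λ u t → ≡.sym (dist≡0⇒≡ (distB⇒dist≡ 0 t)))

  sphere-empty : ∀ {j} x → D < j → sphere j x ≡ 0
  sphere-empty x D<j = sum-zero (λ u → 𝟙-false (λ t → <⇒≱ D<j (subst (_≤ D) (distB⇒dist≡ _ t) (dist≤D x u))))

  sphere-balance : ∀ j x → sphere j x * b j ≡ sphere (suc j) x * c (suc j)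
  sphere-balance j x = double-count (adj G) (λ u → distB G x u j) (λ w → distB G x w (suc j))
    (λ u t → count-outward (distB⇒dist≡ j t))
    (λ w t → trans (count-adj-sym _ w) (count-inward (distB⇒dist≡ (suc j) t)))

  -- α j x y counts the sources u whose flow uses the edge x → y between layers j and j + 1.
  α : ℕ → Fin n → Fin n → ℕ
  α j x y = count (λ u → distB G x u j ∧ distB G y u (suc j))

  module _ {x y} (x~y : T (adj G x y)) where

    α-zero : α 0 x y ≡ 1
    α-zero = count-unique _ (T-∧⁺ (dist≡⇒distB 0 (dist-refl x)) (dist≡⇒distB 1 (adj⇒dist≡1 y~x)))
                            (λ u t → ≡.sym (dist≡0⇒≡ (distB⇒dist≡ 0 (proj₁ (T-∧⁻ (distB G x u 0) t)))))
      where
      y~x : T (adj G y x)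
      y~x = adj-sym G x~y

    α-balance : ∀ j → α j x y * b (suc j) ≡ α (suc j) x y * c (suc j)
    α-balance j = double-count (adj G) (λ u → distB G x u j ∧ distB G y u (suc j))
                                       (λ u → distB G x u (suc j) ∧ distB G y u (suc (suc j)))
                               outward inward
      where
      outward : ∀ u → T (distB G x u j ∧ distB G y u (suc j)) →
                count (λ u′ → adj G u u′ ∧ (distB G x u′ (suc j) ∧ distB G y u′ (suc (suc j)))) ≡ b (suc j)
      outward u t with T-∧⁻ (distB G x u j) t
      ... | xu , yu = trans (count-∧-dropˡ farther)
                            (count-outward (distB⇒dist≡ (suc j) yu))
        where
        farther : ∀ u′ → T (adj G u u′) → T (distB G y u′ (suc (suc j))) → T (distB G x u′ (suc j))
        farther u′ u~u′ yu′ = dist≡⇒distB (suc j) (≤-antisym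
          (subst (λ d → dist x u′ ≤ suc d) (distB⇒dist≡ j xu) (dist-adjʳ x u~u′))
          (s≤s⁻¹ (subst (_≤ suc (dist x u′)) (distB⇒dist≡ (suc (suc j)) yu′) (dist-adjˡ u′ x~y))))
      inward : ∀ u′ → T (distB G x u′ (suc j) ∧ distB G y u′ (suc (suc j))) →
               count (λ u → adj G u u′ ∧ (distB G x u j ∧ distB G y u (suc j))) ≡ c (suc j)
      inward u′ t with T-∧⁻ (distB G x u′ (suc j)) t
      ... | xu′ , yu′ = trans (count-adj-sym _ u′)
                              (trans (count-∧-dropʳ closer)
                                     (count-inward (distB⇒dist≡ (suc j) xu′)))
        where
        closer : ∀ u → T (adj G u′ u) → T (distB G x u j) → T (distB G y u (suc j))
        closer u u′~u xu = dist≡⇒distB (suc j) (≤-antisym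
          (subst (λ d → dist y u ≤ suc d) (distB⇒dist≡ j xu) (dist-adjˡ u x~y))
          (s≤s⁻¹ (subst (_≤ suc (dist y u)) (distB⇒dist≡ (suc (suc j)) yu′) (dist-adjʳ y (adj-sym G u′~u)))))

    α-sphere : ∀ {j} → j < D → k * α j x y ≡ sphere j x * b j
    α-sphere {zero} _ = begin
      k * α 0 x y     ≡⟨ cong (k *_) α-zero ⟩
      k * 1           ≡⟨ *-comm k 1 ⟩
      1 * k           ≡⟨ cong (_* k) (sphere-zero x) ⟨
      sphere 0 x * k  ∎
      where open ≡-Reasoning
    α-sphere {suc j} sj<D = *-cancelʳ-≡ _ _ (c (suc j)) {{>-nonZero (c-pos (<⇒≤ sj<D))}} (begin
      k * α (suc j) x y * c (suc j)          ≡⟨ *-assoc k (α (suc j) x y) (c (suc j)) ⟩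
      k * (α (suc j) x y * c (suc j))        ≡⟨ cong (k *_) (α-balance j) ⟨
      k * (α j x y * b (suc j))              ≡⟨ *-assoc k (α j x y) (b (suc j)) ⟨
      k * α j x y * b (suc j)                ≡⟨ cong (_* b (suc j)) (α-sphere (<⇒≤ sj<D)) ⟩
      sphere j x * b j * b (suc j)           ≡⟨ cong (_* b (suc j)) (sphere-balance j x) ⟩
      sphere (suc j) x * c (suc j) * b (suc j) ≡⟨ xy∙z≈xz∙y (sphere (suc j) x) (c (suc j)) (b (suc j)) ⟩
      sphere (suc j) x * b (suc j) * c (suc j) ∎)
      where open ≡-Reasoning

-- The uniform flow

module UniformFlow {n : ℕ} (G : Graph n) (D : ℕ) (diameter : HasDiameter G D)
                   (regular : DistanceRegular G) where

  open IntersectionNumbers G D diameter regular public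
  open LayerFlow (layerFlow (b ∘ suc) (c ∘ suc) D (λ _ → c-pos)) public

  flow : Fin n → Fin n → Fin n → ℕ
  flow u x y = 𝟙 (adj G x y ∧ distB G u y (suc (dist u x))) * weight (dist u x)

  conservation-at : ∀ {u y j} → dist u y ≡ suc j → sum (λ x → flow u x y) ≡ rate + sum (λ z → flow u y z)
  conservation-at {u} {y} {j} e = begin
    sum (λ x → flow u x y)
      ≡⟨ sum-cong-≗ inflow ⟩
    sum (λ x → 𝟙 (adj G y x ∧ distB G u x j) * weight j)
      ≡⟨ *-distribʳ-sum (weight j) (λ x → 𝟙 (adj G y x ∧ distB G u x j)) ⟨
    count (λ x → adj G y x ∧ distB G u x j) * weight j
      ≡⟨ cong (_* weight j) (count-inward e) ⟩
    c (suc j) * weight j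
      ≡⟨ balance j (subst (_≤ D) e (dist≤D u y)) ⟩
    rate + b (suc j) * weight (suc j)
      ≡⟨ cong (λ m → rate + m * weight (suc j)) (count-outward e) ⟨
    rate + count (λ z → adj G y z ∧ distB G u z (suc (suc j))) * weight (suc j)
      ≡⟨ cong (rate +_) (*-distribʳ-sum (weight (suc j)) (λ z → 𝟙 (adj G y z ∧ distB G u z (suc (suc j))))) ⟩
    rate + sum (λ z → 𝟙 (adj G y z ∧ distB G u z (suc (suc j))) * weight (suc j))
      ≡⟨ cong (λ d → rate + sum (λ z → 𝟙 (adj G y z ∧ distB G u z (suc d)) * weight d)) e ⟨
    rate + sum (λ z → flow u y z) ∎
    where
    open ≡-Reasoning
    inflow : ∀ x → flow u x y ≡ 𝟙 (adj G y x ∧ distB G u x j) * weight j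
    inflow x = 𝟙*-cong₂ to from (λ t → cong weight (on-layer t))
      where
      on-layer : T (adj G x y ∧ distB G u y (suc (dist u x))) → dist u x ≡ j
      on-layer t = suc-injective (trans (≡.sym (distB⇒dist≡ _ (proj₂ (T-∧⁻ (adj G x y) t)))) e)
      to : T (adj G x y ∧ distB G u y (suc (dist u x))) → T (adj G y x ∧ distB G u x j)
      to t = T-∧⁺ (adj-sym G (proj₁ (T-∧⁻ (adj G x y) t))) (dist≡⇒distB j (on-layer t))
      from : T (adj G y x ∧ distB G u x j) → T (adj G x y ∧ distB G u y (suc (dist u x)))
      from t with T-∧⁻ (adj G y x) t
      ... | y~x , ux = T-∧⁺ (adj-sym G y~x) (dist≡⇒distB _ (trans e (cong suc (≡.sym (distB⇒dist≡ j ux)))))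

  conservation : ∀ {u y} → y ≢ u → sum (λ x → flow u x y) ≡ rate + sum (λ z → flow u y z)
  conservation {u} {y} y≢u = by-distance (dist u y) refl
    where
    by-distance : ∀ d → dist u y ≡ d → sum (λ x → flow u x y) ≡ rate + sum (λ z → flow u y z)
    by-distance zero    e = ⊥-elim (y≢u (≡.sym (dist≡0⇒≡ e)))
    by-distance (suc j) e = conservation-at e

  load : Fin n → Fin n → ℕ
  load x y = sum (λ u → 𝟙 (distB G u y (suc (dist u x))) * weight (dist u x))

  sum-flow : ∀ x y → sum (λ u → flow u x y) ≡ 𝟙 (adj G x y) * load x y
  sum-flow x y =
    trans (sum-cong-≗ split)
          (≡.sym (*-distribˡ-sum (𝟙 (adj G x y)) (λ u → 𝟙 (distB G u y (suc (dist u x))) * weight (dist u x))))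
    where
    split : ∀ u → flow u x y ≡ 𝟙 (adj G x y) * (𝟙 (distB G u y (suc (dist u x))) * weight (dist u x))
    split u = trans (cong (_* weight (dist u x)) (𝟙-∧ (adj G x y) _)) (*-assoc (𝟙 (adj G x y)) _ _)

  outside : ℕ → Fin n → ℕ
  outside j x = count (λ u → j <ᵇ dist x u)

  outside-split : ∀ j x → outside j x ≡ sphere (suc j) x + outside (suc j) x
  outside-split j x =
    trans (sum-cong-≗ split) (∑-distrib-+ (λ u → 𝟙 (distB G x u (suc j))) (λ u → 𝟙 (suc j <ᵇ dist x u)))
    where
    split : ∀ u → 𝟙 (j <ᵇ dist x u) ≡ 𝟙 (distB G x u (suc j)) + 𝟙 (suc j <ᵇ dist x u)
    split u = trans (𝟙-<ᵇ-split j (dist x u)) (cong (_+ 𝟙 (suc j <ᵇ dist x u)) (≡.sym (𝟙-distB x u (suc j))))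

  outside-empty : ∀ {j} x → D ≤ j → outside j x ≡ 0
  outside-empty x D≤j = sum-zero (λ u → 𝟙-false (λ t → <⇒≱ (<ᵇ⇒< _ _ t) (≤-trans (dist≤D x u) D≤j)))

  outside≤n∸1 : ∀ j x → outside j x ≤ n ∸ 1
  outside≤n∸1 j x = m+n≤o⇒m≤o∸n (outside j x) (begin
    outside j x + 1
      ≡⟨ cong (outside j x +_) (sphere-zero x) ⟨
    outside j x + sphere 0 x
      ≡⟨ ∑-distrib-+ (λ u → 𝟙 (j <ᵇ dist x u)) (λ u → 𝟙 (distB G x u 0)) ⟨
    sum (λ u → 𝟙 (j <ᵇ dist x u) + 𝟙 (distB G x u 0))
      ≡⟨ sum-cong-≗ (λ u → cong (𝟙 (j <ᵇ dist x u) +_) (𝟙-distB x u 0)) ⟩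
    sum (λ u → 𝟙 (j <ᵇ dist x u) + 𝟙 (dist x u ≡ᵇ 0))
      ≤⟨ sum-mono-≤ (λ u → 𝟙-<ᵇ+𝟙-≡ᵇ0≤1 j (dist x u)) ⟩
    sum {n} (λ _ → 1)
      ≡⟨ sum-const n 1 ⟩
    n * 1
      ≡⟨ *-identityʳ n ⟩
    n ∎)
    where open ≤-Reasoning

  -- The left side is the total flow from x over the edges between spheres j and j + 1.
  flow-through-layer : ∀ x j → weight j * (sphere (suc j) x * c (suc j)) ≡ rate * outside j x
  flow-through-layer x = downward-induction (λ j → through j ≡ rate * outside j x) D beyond step
    where
    open ≡-Reasoning
    through : ℕ → ℕ
    through j = weight j * (sphere (suc j) x * c (suc j))
    beyond : ∀ j → D ≤ j → through j ≡ rate * outside j x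
    beyond j D≤j = begin
      through j              ≡⟨ cong (λ m → weight j * (m * c (suc j))) (sphere-empty x (s≤s D≤j)) ⟩
      weight j * 0           ≡⟨ *-zeroʳ (weight j) ⟩
      0                      ≡⟨ *-zeroʳ rate ⟨
      rate * 0               ≡⟨ cong (rate *_) (outside-empty x D≤j) ⟨
      rate * outside j x     ∎
    regroup : ∀ s r β w → s * (r + β * w) ≡ r * s + w * (s * β)
    regroup = solve-∀
    step : ∀ j → j < D → through (suc j) ≡ rate * outside (suc j) x → through j ≡ rate * outside j x
    step j j<D ih = begin
      through j
        ≡⟨ x∙yz≈y∙zx (weight j) (sphere (suc j) x) (c (suc j)) ⟩
      sphere (suc j) x * (c (suc j) * weight j)
        ≡⟨ cong (sphere (suc j) x *_) (balance j j<D) ⟩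
      sphere (suc j) x * (rate + b (suc j) * weight (suc j))
        ≡⟨ regroup (sphere (suc j) x) rate (b (suc j)) (weight (suc j)) ⟩
      rate * sphere (suc j) x + weight (suc j) * (sphere (suc j) x * b (suc j))
        ≡⟨ cong (λ m → rate * sphere (suc j) x + weight (suc j) * m) (sphere-balance (suc j) x) ⟩
      rate * sphere (suc j) x + through (suc j)
        ≡⟨ cong (rate * sphere (suc j) x +_) ih ⟩
      rate * sphere (suc j) x + rate * outside (suc j) x
        ≡⟨ *-distribˡ-+ rate (sphere (suc j) x) (outside (suc j) x) ⟨
      rate * (sphere (suc j) x + outside (suc j) x)
        ≡⟨ cong (rate *_) (outside-split j x) ⟨
      rate * outside j x ∎

  load≤∑layers : ∀ x y → load x y ≤ sum {D} (λ j → weight (toℕ j) * α (toℕ j) x y)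
  load≤∑layers x y = begin
    sum (λ u → 𝟙 (distB G u y (suc (dist u x))) * weight (dist u x))
      ≤⟨ sum-mono-≤ (λ u → 𝟙*≤-intro (distB G u y (suc (dist u x))) (one-layer u)) ⟩
    sum (λ u → sum {D} (λ j → term (toℕ j) u))
      ≡⟨ ∑-comm {n} {D} (λ u j → term (toℕ j) u) ⟩
    sum {D} (λ j → sum (λ u → term (toℕ j) u))
      ≡⟨ sum-cong-≗ {D} (λ j → *-distribˡ-sum (weight (toℕ j))
                                               (λ u → 𝟙 (distB G x u (toℕ j) ∧ distB G y u (suc (toℕ j))))) ⟨
    sum {D} (λ j → weight (toℕ j) * α (toℕ j) x y) ∎
    where
    open ≤-Reasoning
    term : ℕ → Fin n → ℕ
    term d u = weight d * 𝟙 (distB G x u d ∧ distB G y u (suc d))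
    one-layer : ∀ u → T (distB G u y (suc (dist u x))) → weight (dist u x) ≤ sum {D} (λ j → term (toℕ j) u)
    one-layer u t = begin
      weight (dist u x)                    ≡⟨ *-identityʳ _ ⟨
      weight (dist u x) * 1                ≡⟨ cong (weight (dist u x) *_) (𝟙-true on-layer) ⟨
      term (dist u x) u                    ≡⟨ cong (λ d → term d u) (toℕ-fromℕ< ux<D) ⟨
      term (toℕ (fromℕ< ux<D)) u           ≤⟨ term≤sum (λ j → term (toℕ j) u) (fromℕ< ux<D) ⟩
      sum {D} (λ j → term (toℕ j) u)       ∎
      where
      uy≡1+ux : dist u y ≡ suc (dist u x)
      uy≡1+ux = distB⇒dist≡ _ t
      ux<D : dist u x < D
      ux<D = subst (_≤ D) uy≡1+ux (dist≤D u y)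
      on-layer : T (distB G x u (dist u x) ∧ distB G y u (suc (dist u x)))
      on-layer = T-∧⁺ (dist≡⇒distB _ (dist-sym x u)) (dist≡⇒distB _ (trans (dist-sym y u) uy≡1+ux))

  k*load≤ : ∀ {x y} → T (adj G x y) → k * load x y ≤ D * (rate * (n ∸ 1))
  k*load≤ {x} {y} x~y = begin
    k * load x y
      ≤⟨ *-monoʳ-≤ k (load≤∑layers x y) ⟩
    k * sum {D} (λ j → weight (toℕ j) * α (toℕ j) x y)
      ≡⟨ *-distribˡ-sum {D} k (λ j → weight (toℕ j) * α (toℕ j) x y) ⟩
    sum {D} (λ j → k * (weight (toℕ j) * α (toℕ j) x y))
      ≡⟨ sum-cong-≗ {D} (λ j → through-layer (toℕ j) (toℕ<n j)) ⟩
    sum {D} (λ j → rate * outside (toℕ j) x)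
      ≤⟨ sum-mono-≤ {D} (λ j → *-monoʳ-≤ rate (outside≤n∸1 (toℕ j) x)) ⟩
    sum {D} (λ _ → rate * (n ∸ 1))
      ≡⟨ sum-const D (rate * (n ∸ 1)) ⟩
    D * (rate * (n ∸ 1)) ∎
    where
    open ≤-Reasoning
    through-layer : ∀ j → j < D → k * (weight j * α j x y) ≡ rate * outside j x
    through-layer j j<D = begin-equality
      k * (weight j * α j x y)                   ≡⟨ x∙yz≈y∙xz k (weight j) (α j x y) ⟩
      weight j * (k * α j x y)                   ≡⟨ cong (weight j *_) (α-sphere x~y j<D) ⟩
      weight j * (sphere j x * b j)              ≡⟨ cong (weight j *_) (sphere-balance j x) ⟩
      weight j * (sphere (suc j) x * c (suc j))  ≡⟨ flow-through-layer x j ⟩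
      rate * outside j x                             ∎

  k*∑flow≤ : ∀ x y → k * sum (λ u → flow u x y) ≤ D * (rate * (n ∸ 1)) * 𝟙 (adj G x y)
  k*∑flow≤ x y = begin
    k * sum (λ u → flow u x y)              ≡⟨ cong (k *_) (sum-flow x y) ⟩
    k * (𝟙 (adj G x y) * load x y)          ≡⟨ x∙yz≈y∙xz k (𝟙 (adj G x y)) (load x y) ⟩
    𝟙 (adj G x y) * (k * load x y)          ≤⟨ 𝟙*-mono-≤ (adj G x y) k*load≤ ⟩
    𝟙 (adj G x y) * (D * (rate * (n ∸ 1)))  ≡⟨ *-comm (𝟙 (adj G x y)) _ ⟩
    D * (rate * (n ∸ 1)) * 𝟙 (adj G x y)    ∎
    where open ≤-Reasoning

  cut-bound : ∀ (s : Fin n → Bool) →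
              k * (count s * count (not ∘ s)) ≤ D * (n ∸ 1) * crossing (λ x y → 𝟙 (adj G x y)) s (not ∘ s)
  cut-bound s = *-cancelˡ-≤ rate {{>-nonZero rate-pos}} (begin
    rate * (k * (count s * count (not ∘ s)))
      ≡⟨ regroup rate k (count s) (count (not ∘ s)) ⟩
    k * (count s * (rate * count (not ∘ s)))
      ≡⟨ cong (k *_) (*-distribʳ-sum (rate * count (not ∘ s)) (𝟙 ∘ s)) ⟩
    k * sum (λ u → 𝟙 (s u) * (rate * count (not ∘ s)))
      ≤⟨ *-monoʳ-≤ k (sum-mono-≤ (λ u → 𝟙*-mono-≤ (s u) (λ su → demand≤crossing (flow u) s (conserved su)))) ⟩
    k * sum (λ u → 𝟙 (s u) * crossing (flow u) s (not ∘ s))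
      ≤⟨ *-monoʳ-≤ k (sum-mono-≤ (λ u → 𝟙*≤ (s u) _)) ⟩
    k * sum (λ u → crossing (flow u) s (not ∘ s))
      ≡⟨ cong (k *_) (sum-crossing flow s (not ∘ s)) ⟩
    k * crossing (λ x y → sum (λ u → flow u x y)) s (not ∘ s)
      ≡⟨ *-crossing k (λ x y → sum (λ u → flow u x y)) s (not ∘ s) ⟩
    crossing (λ x y → k * sum (λ u → flow u x y)) s (not ∘ s)
      ≤⟨ crossing-mono-≤ s (not ∘ s) k*∑flow≤ ⟩
    crossing (λ x y → D * (rate * (n ∸ 1)) * 𝟙 (adj G x y)) s (not ∘ s)
      ≡⟨ *-crossing (D * (rate * (n ∸ 1))) (λ x y → 𝟙 (adj G x y)) s (not ∘ s) ⟨
    D * (rate * (n ∸ 1)) * crossing (λ x y → 𝟙 (adj G x y)) s (not ∘ s)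
      ≡⟨ regroup′ D rate (n ∸ 1) _ ⟩
    rate * (D * (n ∸ 1) * crossing (λ x y → 𝟙 (adj G x y)) s (not ∘ s)) ∎)
    where
    open ≤-Reasoning
    regroup : ∀ r k a b → r * (k * (a * b)) ≡ k * (a * (r * b))
    regroup = solve-∀
    regroup′ : ∀ d r m e → d * (r * m) * e ≡ r * (d * m * e)
    regroup′ = solve-∀
    conserved : ∀ {u} → T (s u) → ∀ y → T (not (s y)) → sum (λ x → flow u x y) ≡ rate + sum (λ z → flow u y z)
    conserved su y ȳ = conservation (λ { refl → T-not⁻ ȳ su })

-- Subsets and the approximation bounds

∣∣≡count : ∀ {n} (S : Subset n) → ∣ S ∣ ≡ count (lookup S)
∣∣≡count []          = refl
∣∣≡count (true  ∷ S) = cong suc (∣∣≡count S)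
∣∣≡count (false ∷ S) = ∣∣≡count S

lookup-⁅⁆⁻ : ∀ {n} {v x : Fin n} → T (lookup ⁅ v ⁆ x) → x ≡ v
lookup-⁅⁆⁻ {v = v} {x} t = x∈⁅y⁆⇒x≡y v (lookup⇒[]= x ⁅ v ⁆ (Equivalence.to T-≡ t))

lookup-⁅⁆⁺ : ∀ {n} (v : Fin n) → T (lookup ⁅ v ⁆ v)
lookup-⁅⁆⁺ v = Equivalence.from T-≡ ([]=⇒lookup (x∈⁅x⁆ v))

boundary≡crossing : ∀ {n} (G : Graph n) S →
                    boundary G S ≡ crossing (λ x y → 𝟙 (adj G x y)) (lookup S) (not ∘ lookup S)
boundary≡crossing G S =
  trans (length-filter-cartesianProduct cut-edge id id)
        (sum-cong-≗ (λ x → sum-cong-≗ (λ y → 𝟙-∧∧ (lookup S x) (not (lookup S y)) (adj G x y))))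
  where
  cut-edge : Fin _ × Fin _ → Bool
  cut-edge (x , y) = lookup S x ∧ not (lookup S y) ∧ adj G x y
  𝟙-∧∧ : ∀ a b c → 𝟙 (a ∧ b ∧ c) ≡ 𝟙 a * (𝟙 b * 𝟙 c)
  𝟙-∧∧ a b c = trans (𝟙-∧ a (b ∧ c)) (cong (𝟙 a *_) (𝟙-∧ b c))

-- `ℤ.+ a / suc p` is `fromℚᵘ (mkℚᵘ (ℤ.+ a) p)` by definition, so the comparison is made in ℚᵘ.
frac-≤ : ∀ a p c q d → 1 ≤ p → 1 ≤ q → a * q ≤ d * c * p → frac a p ≤ℚ ℕ→ℚ d *ℚ frac c q
frac-≤ a (suc p) c (suc q) d _ _ le = ℚₚ.toℚᵘ-cancel-≤ (begin
  toℚᵘ (ℤ.+ a / suc p)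
    ≃⟨ ℚₚ.toℚᵘ-fromℚᵘ (mkℚᵘ (ℤ.+ a) p) ⟩
  mkℚᵘ (ℤ.+ a) p
    ≤⟨ ℚᵘ.*≤* (subst₂ ℤ._≤_ (ℤₚ.pos-* a (1 * suc q)) numerator (ℤ.+≤+ cross-multiplied)) ⟩
  mkℚᵘ (ℤ.+ d) 0 ℚᵘ.* mkℚᵘ (ℤ.+ c) q
    ≃⟨ ℚᵘₚ.*-cong (ℚₚ.toℚᵘ-fromℚᵘ (mkℚᵘ (ℤ.+ d) 0)) (ℚₚ.toℚᵘ-fromℚᵘ (mkℚᵘ (ℤ.+ c) q)) ⟨
  toℚᵘ (ℤ.+ d / 1) ℚᵘ.* toℚᵘ (ℤ.+ c / suc q)
    ≃⟨ ℚₚ.toℚᵘ-homo-* (ℤ.+ d / 1) (ℤ.+ c / suc q) ⟨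
  toℚᵘ ((ℤ.+ d / 1) *ℚ (ℤ.+ c / suc q)) ∎)
  where
  open ℚᵘₚ.≤-Reasoning
  numerator : ℤ.+ (d * c * suc p) ≡ ℤ.+ d ℤ.* ℤ.+ c ℤ.* ℤ.+ suc p
  numerator = trans (ℤₚ.pos-* (d * c) (suc p)) (cong (ℤ._* ℤ.+ suc p) (ℤₚ.pos-* d c))
  cross-multiplied : a * (1 * suc q) ≤ d * c * suc p
  cross-multiplied = subst (λ m → a * m ≤ d * c * suc p) (≡.sym (*-identityˡ (suc q))) le

module Approximation {n : ℕ} (G : Graph n) (D : ℕ) (diameter : HasDiameter G D)
                     (regular : DistanceRegular G) where

  open UniformFlow G D diameter regular

  boundary-⁅⁆ : ∀ v → boundary G ⁅ v ⁆ ≡ k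
  boundary-⁅⁆ v = begin
    boundary G ⁅ v ⁆
      ≡⟨ boundary≡crossing G ⁅ v ⁆ ⟩
    sum (λ x → sum (λ y → 𝟙 (s x) * (𝟙 (not (s y)) * 𝟙 (adj G x y))))
      ≡⟨ sum-cong-≗ (λ x → *-distribˡ-sum (𝟙 (s x)) (λ y → 𝟙 (not (s y)) * 𝟙 (adj G x y))) ⟨
    sum (λ x → 𝟙 (s x) * sum (λ y → 𝟙 (not (s y)) * 𝟙 (adj G x y)))
      ≡⟨ sum-𝟙*-unique s (λ x → sum (λ y → 𝟙 (not (s y)) * 𝟙 (adj G x y))) (lookup-⁅⁆⁺ v) (λ _ → lookup-⁅⁆⁻) ⟩
    sum (λ y → 𝟙 (not (s y)) * 𝟙 (adj G v y))
      ≡⟨ sum-cong-≗ (λ y → trans (≡.sym (𝟙-∧ (not (s y)) (adj G v y))) (𝟙-cong neighbour⁺ neighbour⁻)) ⟩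
    count (λ y → adj G v y ∧ distB G v y 1)
      ≡⟨ count-outward (dist-refl v) ⟩
    k ∎
    where
    open ≡-Reasoning
    s : Fin n → Bool
    s = lookup ⁅ v ⁆
    neighbour⁺ : ∀ {y} → T (not (s y) ∧ adj G v y) → T (adj G v y ∧ distB G v y 1)
    neighbour⁺ {y} t with T-∧⁻ (not (s y)) t
    ... | _ , v~y = T-∧⁺ v~y (dist≡⇒distB 1 (adj⇒dist≡1 v~y))
    neighbour⁻ : ∀ {y} → T (adj G v y ∧ distB G v y 1) → T (not (s y) ∧ adj G v y)
    neighbour⁻ {y} t with T-∧⁻ (adj G v y) t
    ... | v~y , _ = T-∧⁺ (T-not⁺ (λ sy → not-loop (lookup-⁅⁆⁻ sy) v~y)) v~y
      where
      not-loop : y ≡ v → ¬ T (adj G v y)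
      not-loop refl = adj-irrefl G

  subset-cut-bound : ∀ S → k * (∣ S ∣ * (n ∸ ∣ S ∣)) ≤ D * (n ∸ 1) * boundary G S
  subset-cut-bound S = begin
    k * (∣ S ∣ * (n ∸ ∣ S ∣))
      ≡⟨ cong (λ m → k * (m * (n ∸ m))) (∣∣≡count S) ⟩
    k * (count (lookup S) * (n ∸ count (lookup S)))
      ≡⟨ cong (λ m → k * (count (lookup S) * m)) (count-not (lookup S)) ⟨
    k * (count (lookup S) * count (not ∘ lookup S))
      ≤⟨ cut-bound (lookup S) ⟩
    D * (n ∸ 1) * crossing (λ x y → 𝟙 (adj G x y)) (lookup S) (not ∘ lookup S)
      ≡⟨ cong (D * (n ∸ 1) *_) (boundary≡crossing G S) ⟨
    D * (n ∸ 1) * boundary G S ∎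
    where open ≤-Reasoning

  sparsity-approximation : 2 ≤ n → ∀ v S → 1 ≤ ∣ S ∣ → ∣ S ∣ < n →
                           sparsityOf G ⁅ v ⁆ ≤ℚ (ℕ→ℚ D *ℚ sparsityOf G S)
  sparsity-approximation 2≤n v S 1≤∣S∣ ∣S∣<n =
    frac-≤ (boundary G ⁅ v ⁆) (∣ ⁅ v ⁆ ∣ * (n ∸ ∣ ⁅ v ⁆ ∣)) (boundary G S) (∣ S ∣ * (n ∸ ∣ S ∣)) D
           (subst (λ m → 1 ≤ m * (n ∸ m)) (≡.sym (∣⁅x⁆∣≡1 v)) 1≤1*[n∸1])
           (*-mono-≤ 1≤∣S∣ (m+n≤o⇒m≤o∸n 1 ∣S∣<n))
           (begin
      boundary G ⁅ v ⁆ * (∣ S ∣ * (n ∸ ∣ S ∣))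
        ≡⟨ cong (_* (∣ S ∣ * (n ∸ ∣ S ∣))) (boundary-⁅⁆ v) ⟩
      k * (∣ S ∣ * (n ∸ ∣ S ∣))
        ≤⟨ subset-cut-bound S ⟩
      D * (n ∸ 1) * boundary G S
        ≡⟨ regroup D (n ∸ 1) (boundary G S) ⟩
      D * boundary G S * (1 * (n ∸ 1))
        ≡⟨ cong (λ m → D * boundary G S * (m * (n ∸ m))) (∣⁅x⁆∣≡1 v) ⟨
      D * boundary G S * (∣ ⁅ v ⁆ ∣ * (n ∸ ∣ ⁅ v ⁆ ∣)) ∎)
    where
    open ≤-Reasoning
    1≤1*[n∸1] : 1 ≤ 1 * (n ∸ 1)
    1≤1*[n∸1] = subst (1 ≤_) (≡.sym (*-identityˡ (n ∸ 1))) (m+n≤o⇒m≤o∸n 1 2≤n)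
    regroup : ∀ d m β → d * m * β ≡ d * β * (1 * m)
    regroup = solve-∀

  expansion-approximation : ∀ v S → 1 ≤ ∣ S ∣ → 2 * ∣ S ∣ ≤ n →
                            ℕ→ℚ (boundary G ⁅ v ⁆) ≤ℚ (ℕ→ℚ (2 * D) *ℚ expansionOf G S)
  expansion-approximation v S 1≤∣S∣ 2∣S∣≤n =
    frac-≤ (boundary G ⁅ v ⁆) 1 (boundary G S) ∣ S ∣ (2 * D) ≤-refl 1≤∣S∣
           (*-cancelʳ-≤ _ _ (n ∸ ∣ S ∣) {{>-nonZero (≤-trans 1≤∣S∣ (2*m≤n⇒m≤n∸m {∣ S ∣} 2∣S∣≤n))}} (begin
      boundary G ⁅ v ⁆ * ∣ S ∣ * (n ∸ ∣ S ∣)  ≡⟨ cong (λ β → β * ∣ S ∣ * (n ∸ ∣ S ∣)) (boundary-⁅⁆ v) ⟩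
      k * ∣ S ∣ * (n ∸ ∣ S ∣)                 ≡⟨ *-assoc k ∣ S ∣ (n ∸ ∣ S ∣) ⟩
      k * (∣ S ∣ * (n ∸ ∣ S ∣))               ≤⟨ subset-cut-bound S ⟩
      D * (n ∸ 1) * boundary G S              ≤⟨ *-monoˡ-≤ (boundary G S) (*-monoʳ-≤ D n∸1≤2[n∸∣S∣]) ⟩
      D * (2 * (n ∸ ∣ S ∣)) * boundary G S    ≡⟨ regroup D (n ∸ ∣ S ∣) (boundary G S) ⟩
      2 * D * boundary G S * 1 * (n ∸ ∣ S ∣)  ∎))
    where
    open ≤-Reasoning
    n∸1≤2[n∸∣S∣] : n ∸ 1 ≤ 2 * (n ∸ ∣ S ∣)
    n∸1≤2[n∸∣S∣] = ≤-trans (m∸n≤m n 1) (2*m≤n⇒n≤2*[n∸m] {∣ S ∣} 2∣S∣≤n)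
    regroup : ∀ d m β → d * (2 * m) * β ≡ 2 * d * β * 1 * m
    regroup = solve-∀

corollary4p4 : (n : ℕ) → 2 ≤ n → (G : Graph n) → (D : ℕ) →
    DistanceRegular G → HasDiameter G D → (v : Fin n) →
    ((S : Subset n) → 1 ≤ ∣ S ∣ → ∣ S ∣ < n →
      sparsityOf G ⁅ v ⁆ ≤ℚ (ℕ→ℚ D *ℚ sparsityOf G S))
    ×
    ((S : Subset n) → 1 ≤ ∣ S ∣ → 2 Data.Nat.* ∣ S ∣ ≤ n →
      ℕ→ℚ (boundary G ⁅ v ⁆) ≤ℚ (ℕ→ℚ (2 Data.Nat.* D) *ℚ expansionOf G S))
corollary4p4 n 2≤n G D regular diameter v =
  sparsity-approximation 2≤n v , expansion-approximation v
  where open Approximation G D diameter regular
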